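{- Let $n\geq 3$ be odd and let $C_n$ be the cycle on $n$ vertices. Then $b_2(C_n)=\frac{n+1}{2}$.
   Context: For a finite simple graph $G=(V,E)$, a biclique on a subset of $V$ is given by two disjoint sets $X,Y\subseteq V$; its edges are all pairs $\{x,y\}$ with $x\in X$, $y\in Y$. An odd cover of $G$ is a collection of bicliques on subsets of $V$ such that every pair of vertices adjacent in $G$ is an edge of an odd number of the bicliques, and every pair of distinct non-adjacent vertices is an edge of an even number of the bicliques. $b_2(G)$ denotes the minimum cardinality of an odd cover of $G$. -}

module Defs where

open import Data.Nat using (ℕ; zero; suc; _%_; _≡ᵇ_)
open import Data.Nat.Properties using ()
open import Data.Fin using (Fin; toℕ)
open import Data.Bool using (Bool; true; false; _∧_; _∨_; if_then_else_)
open import Data.List using (List; length; filterᵇ)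
open import Data.Product using (_×_; Σ; ∃)
open import Relation.Binary.PropositionalEquality using (_≡_; _≢_)
open import Relation.Nullary using (¬_)

-- Only pairs
-- of distinct vertices are ever consulted below.
Graph : ℕ → Set
Graph n = Fin n → Fin n → Bool

record Biclique (n : ℕ) : Set where
  field
    X : Fin n → Bool
    Y : Fin n → Bool
    disjoint : ∀ v → ¬ (X v ≡ true × Y v ≡ true)
open Biclique public

hasEdge : ∀ {n} → Biclique n → Fin n → Fin n → Bool
hasEdge B u v = (X B u ∧ Y B v) ∨ (Y B u ∧ X B v)

edgeCount : ∀ {n} → List (Biclique n) → Fin n → Fin n → ℕ
edgeCount Bs u v = length (filterᵇ (λ B → hasEdge B u v) Bs)

IsOddCover : ∀ {n} → Graph n → List (Biclique n) → Set
IsOddCover G Bs = ∀ u v → u ≢ v →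
  edgeCount Bs u v % 2 ≡ (if G u v then 1 else 0)

b₂≡ : ∀ {n} → Graph n → ℕ → Set
b₂≡ G k = (Σ (List _) λ Bs → IsOddCover G Bs × length Bs ≡ k)
        × (∀ Bs → IsOddCover G Bs → k Data.Nat.≤ length Bs)

C : (n : ℕ) → Fin n → Fin n → Bool
C zero () _
C (suc k) u v =
  (suc (toℕ u) % suc k ≡ᵇ toℕ v) ∨ (suc (toℕ v) % suc k ≡ᵇ toℕ u)

-- Over F₂ an odd cover {(Xᵢ , Yᵢ)} of G is a decomposition A = Σᵢ (xᵢ yᵢᵀ + yᵢ xᵢᵀ) of the
-- adjacency matrix of G, where xᵢ, yᵢ are the indicator vectors of the sides.  Let n = 2h + 1.
-- The stars centred at 1, 3, …, 2h − 1 (each the sum of its two edges) together with the edge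
-- {2h , 0} sum to the adjacency matrix of C_n, so h + 1 bicliques suffice.  Conversely, h
-- bicliques give only 2h < n side vectors, so some w ≠ 0 is orthogonal to all of them; then
-- A w = 0, i.e. w(a − 1) = w(a + 1) for every vertex a, and since n is odd w is the all-ones
-- vector, so every side has even size.  But the sum of the entries of A below the diagonal is
-- the number n of edges, which is odd, while it also equals Σᵢ |Xᵢ| |Yᵢ| ≡ 0.

module Submission where

open import Defs
open import Data.Nat using (ℕ; _≤_; _%_; _/_; _+_)
open import Relation.Binary.PropositionalEquality using (_≡_)

open import Algebra.Bundles using (CommutativeRing)
open import Data.Bool using (Bool; true; false; not; _∧_; _∨_; _xor_; if_then_else_)
open import Data.Bool.Properties
  using ( ∧-assoc; ∧-comm; ∧-identityʳ; ∧-zeroʳ; ∨-identityʳ; ∧-distribˡ-xor; ∧-distribʳ-xor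
        ; xor-assoc; xor-comm; xor-identityʳ; xor-same; not-involutive; ¬-not; T-≡
        ; xor-∧-commutativeRing)
  renaming (_≟_ to _≟ᵇ_)
open import Algebra.Properties.CommutativeSemigroup
  (CommutativeRing.+-commutativeSemigroup xor-∧-commutativeRing) using (interchange)
open import Data.Empty using (⊥; ⊥-elim)
open import Data.Fin as Fin using (Fin; toℕ; fromℕ<)
open import Data.Fin.Properties using (toℕ<n; toℕ-fromℕ<)
open import Data.List using (List; []; _∷_; length; map; filterᵇ; downFrom)
open import Data.List.Properties using (length-map; length-downFrom; length-removeAt′)
open import Data.List.Relation.Unary.All as All using (All; []; _∷_)
open import Data.List.Relation.Unary.All.Properties using (─⁻; map⁻)
open import Data.List.Relation.Unary.All.Properties.Core using (¬Any⇒All¬)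
open import Data.List.Relation.Unary.Any as Any using (Any; any?; _─_)
open import Data.List.Relation.Unary.Any.Properties using (lookup-result)
open import Data.Nat using (zero; suc; _*_; _<_; _≡ᵇ_; z≤n; s≤s; s≤s⁻¹)
open import Data.Nat.DivMod using (m≡m%n+[m/n]*n; m*n/n≡m; m%n<n; m<n⇒m%n≡m; n%n≡0; %-distribˡ-+)
open import Data.Nat.Properties
  using ( ≤-refl; ≤-trans; <-trans; n≤1+n; n<1+n; m<n⇒m<1+n; m<1+n⇒m<n∨m≡n; <⇒≢; >⇒≢; 1+n≢n
        ; ≮⇒≥; *-monoˡ-≤; *-cancelʳ-≤; +-comm; ≡ᵇ⇒≡; ≡⇒≡ᵇ)
open import Data.Product using (_×_; _,_; ∃-syntax)
open import Data.Sum using (inj₁; inj₂)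
open import Function using (_∘_)
open import Function.Bundles using (Equivalence)
open import Relation.Binary.PropositionalEquality
  using (_≢_; refl; sym; trans; cong; cong₂; subst; subst₂; ≢-sym; module ≡-Reasoning)
open import Relation.Nullary using (¬_; yes; no; contradiction)

open ≡-Reasoning

bit : Bool → ℕ
bit b = if b then 1 else 0

bit-injective : ∀ {p q} → bit p ≡ bit q → p ≡ q
bit-injective {false} {false} _ = refl
bit-injective {true}  {true}  _ = refl
bit-injective {false} {true}  ()
bit-injective {true}  {false} ()

xor≡false⇒≡ : ∀ {p q} → p xor q ≡ false → p ≡ q
xor≡false⇒≡ {false} {false} _ = refl
xor≡false⇒≡ {true}  {true}  _ = refl
xor≡false⇒≡ {false} {true}  ()
xor≡false⇒≡ {true}  {false} ()

∨≡xor : ∀ {p q} → (p ≡ true → q ≡ true → ⊥) → p ∨ q ≡ p xor q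
∨≡xor {false}        _    = refl
∨≡xor {true} {false} _    = refl
∨≡xor {true} {true}  both = ⊥-elim (both refl refl)

¬both⇒∧≡false : ∀ {p q} → ¬ (p ≡ true × q ≡ true) → p ∧ q ≡ false
¬both⇒∧≡false {true}  {true}  ¬both = ⊥-elim (¬both (refl , refl))
¬both⇒∧≡false {true}  {false} _     = refl
¬both⇒∧≡false {false}         _     = refl

disjoint-∨≡xor : ∀ xu yu xv yv → xu ∧ yu ≡ false → (xu ∧ yv) ∨ (yu ∧ xv) ≡ (xu ∧ yv) xor (yu ∧ xv)
disjoint-∨≡xor true  true  xv yv ()
disjoint-∨≡xor true  false xv yv _ = trans (∨-identityʳ yv) (sym (xor-identityʳ yv))
disjoint-∨≡xor false yu    xv yv _ = refl

triangle-step : ∀ p q X Y → p ∧ q ≡ false → ((p ∧ Y) xor (q ∧ X)) xor (X ∧ Y) ≡ (p xor X) ∧ (q xor Y)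
triangle-step false false X     Y     _  = refl
triangle-step true  true  X     Y     ()
triangle-step true  false true  true  _  = refl
triangle-step true  false true  false _  = refl
triangle-step true  false false true  _  = refl
triangle-step true  false false false _  = refl
triangle-step false true  true  true  _  = refl
triangle-step false true  true  false _  = refl
triangle-step false true  false true  _  = refl
triangle-step false true  false false _  = refl

≡ᵇ-refl : ∀ n → (n ≡ᵇ n) ≡ true
≡ᵇ-refl n = Equivalence.to T-≡ (≡⇒≡ᵇ n n refl)

≡ᵇ≡true⇒≡ : ∀ {m n} → (m ≡ᵇ n) ≡ true → m ≡ n
≡ᵇ≡true⇒≡ {m} {n} e = ≡ᵇ⇒≡ m n (Equivalence.from T-≡ e)

≢⇒≡ᵇ≡false : ∀ {m n} → m ≢ n → (m ≡ᵇ n) ≡ false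
≢⇒≡ᵇ≡false m≢n = ¬-not (m≢n ∘ ≡ᵇ≡true⇒≡)

≡ᵇ-sym : ∀ m n → (m ≡ᵇ n) ≡ (n ≡ᵇ m)
≡ᵇ-sym zero    zero    = refl
≡ᵇ-sym zero    (suc n) = refl
≡ᵇ-sym (suc m) zero    = refl
≡ᵇ-sym (suc m) (suc n) = ≡ᵇ-sym m n

singletons-disjoint : ∀ {p q} → p ≢ q → ∀ a → (a ≡ᵇ p) ∧ (a ≡ᵇ q) ≡ false
singletons-disjoint {p} {q} p≢q a with a ≡ᵇ p in a≡ᵇp
... | false = refl
... | true  = ≢⇒≡ᵇ≡false {a} {q} (λ a≡q → p≢q (trans (sym (≡ᵇ≡true⇒≡ {a} {p} a≡ᵇp)) a≡q))

-- A vector of F₂ⁿ is a function ℕ → Bool of which only the coordinates below n are read;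
-- ⨁ is summation in F₂, and ⨁[ a < n ] sums over downFrom n = n − 1 , … , 0.

private variable
  A B : Set

⨁ : (A → Bool) → List A → Bool
⨁ f []       = false
⨁ f (x ∷ xs) = f x xor ⨁ f xs

⨁< : ℕ → (ℕ → Bool) → Bool
⨁< n f = ⨁ f (downFrom n)

infix 5 ⨁ ⨁<
syntax ⨁ (λ x → e) xs = ⨁[ x ∈ xs ] e
syntax ⨁< n (λ a → e) = ⨁[ a < n ] e

⨁-cong : ∀ {f g : A → Bool} → (∀ x → f x ≡ g x) → ∀ xs → ⨁ f xs ≡ ⨁ g xs
⨁-cong f≗g []       = refl
⨁-cong f≗g (x ∷ xs) = cong₂ _xor_ (f≗g x) (⨁-cong f≗g xs)

⨁-zero : ∀ {f : A → Bool} {xs} → All (λ x → f x ≡ false) xs → ⨁ f xs ≡ false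
⨁-zero []               = refl
⨁-zero (fx≡false ∷ fxs) = cong₂ _xor_ fx≡false (⨁-zero fxs)

⨁-xor : ∀ (f g : A → Bool) xs → ⨁[ x ∈ xs ] (f x xor g x) ≡ ⨁ f xs xor ⨁ g xs
⨁-xor f g []       = refl
⨁-xor f g (x ∷ xs) = begin
  (f x xor g x) xor ⨁[ x ∈ xs ] (f x xor g x) ≡⟨ cong ((f x xor g x) xor_) (⨁-xor f g xs) ⟩
  (f x xor g x) xor (⨁ f xs xor ⨁ g xs)       ≡⟨ interchange (f x) (g x) (⨁ f xs) (⨁ g xs) ⟩
  ⨁ f (x ∷ xs) xor ⨁ g (x ∷ xs)              ∎

∧-distribˡ-⨁ : ∀ c (f : A → Bool) xs → c ∧ ⨁ f xs ≡ ⨁[ x ∈ xs ] (c ∧ f x)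
∧-distribˡ-⨁ c f []       = ∧-zeroʳ c
∧-distribˡ-⨁ c f (x ∷ xs) =
  trans (∧-distribˡ-xor c (f x) (⨁ f xs)) (cong ((c ∧ f x) xor_) (∧-distribˡ-⨁ c f xs))

∧-distribʳ-⨁ : ∀ c (f : A → Bool) xs → ⨁ f xs ∧ c ≡ ⨁[ x ∈ xs ] (f x ∧ c)
∧-distribʳ-⨁ c f xs =
  trans (∧-comm (⨁ f xs) c) (trans (∧-distribˡ-⨁ c f xs) (⨁-cong (λ x → ∧-comm c (f x)) xs))

⨁-map : ∀ (f : B → Bool) (g : A → B) xs → ⨁ f (map g xs) ≡ ⨁ (f ∘ g) xs
⨁-map f g []       = refl
⨁-map f g (x ∷ xs) = cong (f (g x) xor_) (⨁-map f g xs)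

⨁-comm : ∀ (f : A → B → Bool) xs ys →
         ⨁[ x ∈ xs ] ⨁[ y ∈ ys ] f x y ≡ ⨁[ y ∈ ys ] ⨁[ x ∈ xs ] f x y
⨁-comm f []       ys = sym (⨁-zero (All.universal (λ _ → refl) ys))
⨁-comm f (x ∷ xs) ys =
  trans (cong (⨁ (f x) ys xor_) (⨁-comm f xs ys)) (sym (⨁-xor (f x) (λ y → ⨁[ x ∈ xs ] f x y) ys))

⨁<-cong : ∀ n {f g : ℕ → Bool} → (∀ a → a < n → f a ≡ g a) → ⨁< n f ≡ ⨁< n g
⨁<-cong zero    f≗g = refl
⨁<-cong (suc n) f≗g = cong₂ _xor_ (f≗g n ≤-refl) (⨁<-cong n λ a a<n → f≗g a (m<n⇒m<1+n a<n))

⨁<-zero : ∀ n {f : ℕ → Bool} → (∀ a → a < n → f a ≡ false) → ⨁< n f ≡ false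
⨁<-zero zero    _       = refl
⨁<-zero (suc n) f≡false = cong₂ _xor_ (f≡false n ≤-refl) (⨁<-zero n λ a a<n → f≡false a (m<n⇒m<1+n a<n))

⨁<-δ : ∀ {p n} (f : ℕ → Bool) → p < n → ⨁[ a < n ] ((a ≡ᵇ p) ∧ f a) ≡ f p
⨁<-δ {p} {zero}  f ()
⨁<-δ {p} {suc n} f p<1+n with m<1+n⇒m<n∨m≡n p<1+n
... | inj₁ p<n  =
  trans (cong (λ t → (t ∧ f n) xor ⨁[ a < n ] ((a ≡ᵇ p) ∧ f a)) (≢⇒≡ᵇ≡false (>⇒≢ p<n))) (⨁<-δ f p<n)
... | inj₂ refl = begin
  ((p ≡ᵇ p) ∧ f p) xor ⨁[ a < p ] ((a ≡ᵇ p) ∧ f a)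
    ≡⟨ cong₂ (λ t s → (t ∧ f p) xor s) (≡ᵇ-refl p)
             (⨁<-zero p λ a a<p → cong (_∧ f a) (≢⇒≡ᵇ≡false (<⇒≢ a<p))) ⟩
  f p xor false
    ≡⟨ xor-identityʳ (f p) ⟩
  f p ∎

⨁<-indicator : ∀ {p n} → p < n → ⨁[ a < n ] (a ≡ᵇ p) ≡ true
⨁<-indicator {p} {n} p<n = trans (⨁<-cong n λ a _ → sym (∧-identityʳ _)) (⨁<-δ (λ _ → true) p<n)

⨁<-pairs : ∀ (f : ℕ → Bool) m → ⨁[ e < m * 2 ] f e ≡ ⨁[ j < m ] (f (suc (j * 2)) xor f (j * 2))
⨁<-pairs f zero    = refl
⨁<-pairs f (suc m) =
  trans (sym (xor-assoc (f (suc (m * 2))) (f (m * 2)) _))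
        (cong ((f (suc (m * 2)) xor f (m * 2)) xor_) (⨁<-pairs f m))

⨁<-true-odd : ∀ h → ⨁[ _ < suc (h * 2) ] true ≡ true
⨁<-true-odd zero    = refl
⨁<-true-odd (suc h) = trans (not-involutive _) (⨁<-true-odd h)

length-filterᵇ-%2 : ∀ (p : A → Bool) xs → length (filterᵇ p xs) % 2 ≡ bit (⨁ p xs)
length-filterᵇ-%2 p [] = refl
length-filterᵇ-%2 p (x ∷ xs) with p x
... | false = length-filterᵇ-%2 p xs
... | true  = begin
  suc (length (filterᵇ p xs)) % 2     ≡⟨ %-distribˡ-+ 1 (length (filterᵇ p xs)) 2 ⟩
  (1 + length (filterᵇ p xs) % 2) % 2 ≡⟨ cong (λ r → (1 + r) % 2) (length-filterᵇ-%2 p xs) ⟩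
  (1 + bit (⨁ p xs)) % 2             ≡⟨ suc-bit (⨁ p xs) ⟩
  bit (not (⨁ p xs))                  ∎
  where
  suc-bit : ∀ b → (1 + bit b) % 2 ≡ bit (not b)
  suc-bit false = refl
  suc-bit true  = refl

-- Homogeneous linear systems over F₂

dot : ℕ → (ℕ → Bool) → (ℕ → Bool) → Bool
dot n u w = ⨁[ a < n ] (u a ∧ w a)

NontrivialSolution : ℕ → List (ℕ → Bool) → Set
NontrivialSolution n Ls = ∃[ w ] (∃[ a ] a < n × w a ≡ true) × All (λ L → dot n L w ≡ false) Ls

update : ℕ → Bool → (ℕ → Bool) → ℕ → Bool
update n d w a = if a ≡ᵇ n then d else w a

eliminate : ℕ → (ℕ → Bool) → (ℕ → Bool) → ℕ → Bool
eliminate n L₀ L a = L a xor (L n ∧ L₀ a)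

update-< : ∀ {n a} d w → a < n → update n d w a ≡ w a
update-< {a = a} d w a<n = cong (if_then d else w a) (≢⇒≡ᵇ≡false (<⇒≢ a<n))

dot-update : ∀ n L w d → dot (suc n) L (update n d w) ≡ (L n ∧ d) xor dot n L w
dot-update n L w d =
  cong₂ _xor_ (cong (λ t → L n ∧ (if t then d else w n)) (≡ᵇ-refl n))
              (⨁<-cong n λ a a<n → cong (L a ∧_) (update-< d w a<n))

dot-eliminate : ∀ n m L₀ L w → dot n (eliminate m L₀ L) w ≡ dot n L w xor (L m ∧ dot n L₀ w)
dot-eliminate n m L₀ L w = begin
  ⨁[ a < n ] ((L a xor (L m ∧ L₀ a)) ∧ w a)
    ≡⟨ ⨁-cong (λ a → trans (∧-distribʳ-xor (w a) (L a) (L m ∧ L₀ a))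
                           (cong ((L a ∧ w a) xor_) (∧-assoc (L m) (L₀ a) (w a)))) (downFrom n) ⟩
  ⨁[ a < n ] ((L a ∧ w a) xor (L m ∧ (L₀ a ∧ w a)))
    ≡⟨ ⨁-xor _ _ (downFrom n) ⟩
  dot n L w xor (⨁[ a < n ] (L m ∧ (L₀ a ∧ w a)))
    ≡⟨ cong (dot n L w xor_) (sym (∧-distribˡ-⨁ (L m) _ (downFrom n))) ⟩
  dot n L w xor (L m ∧ dot n L₀ w) ∎

-- Back substitution: coordinate n of the solution is chosen to satisfy the pivot equation L₀.
eliminate-pivot : ∀ {n Ls} (pivot : Any (λ L → L n ≡ true) Ls) →
                  NontrivialSolution n (map (eliminate n (Any.lookup pivot)) (Ls ─ pivot)) →
                  NontrivialSolution (suc n) Ls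
eliminate-pivot {n} pivot (w , (a , a<n , wa) , solves) =
  update n (dot n L₀ w) w ,
  (a , m<n⇒m<1+n a<n , trans (update-< (dot n L₀ w) w a<n) wa) ,
  ─⁻ pivot (trans (solves-eliminated L₀) L₀-eliminated)
           (All.map (λ {L} → trans (solves-eliminated L)) (map⁻ solves))
  where
  L₀ = Any.lookup pivot

  solves-eliminated : ∀ L → dot (suc n) L (update n (dot n L₀ w) w) ≡ dot n (eliminate n L₀ L) w
  solves-eliminated L = begin
    dot (suc n) L (update n (dot n L₀ w) w) ≡⟨ dot-update n L w (dot n L₀ w) ⟩
    (L n ∧ dot n L₀ w) xor dot n L w        ≡⟨ xor-comm (L n ∧ dot n L₀ w) (dot n L w) ⟩
    dot n L w xor (L n ∧ dot n L₀ w)        ≡⟨ sym (dot-eliminate n n L₀ L w) ⟩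
    dot n (eliminate n L₀ L) w              ∎

  L₀-eliminated : dot n (eliminate n L₀ L₀) w ≡ false
  L₀-eliminated = ⨁<-zero n λ c _ →
    cong (_∧ w c) (trans (cong (λ t → L₀ c xor (t ∧ L₀ c)) (lookup-result pivot)) (xor-same (L₀ c)))

fewer-equations⇒nontrivial-solution : ∀ n (Ls : List (ℕ → Bool)) → length Ls < n →
                                      NontrivialSolution n Ls
fewer-equations⇒nontrivial-solution zero    Ls ()
fewer-equations⇒nontrivial-solution (suc n) Ls len<
  with any? (λ L → L n ≟ᵇ true) Ls
... | yes pivot = eliminate-pivot pivot (fewer-equations⇒nontrivial-solution n _ fewer)
  where
  fewer : length (map (eliminate n (Any.lookup pivot)) (Ls ─ pivot)) < n
  fewer = subst (_< n) (sym (length-map _ (Ls ─ pivot)))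
                (subst (_≤ n) (length-removeAt′ Ls (Any.index pivot)) (s≤s⁻¹ len<))
... | no no-pivot =
  (_≡ᵇ n) , (n , ≤-refl , ≡ᵇ-refl n) , All.map (λ {L} → unit-solves {L}) (¬Any⇒All¬ Ls no-pivot)
  where
  unit-solves : ∀ {L} → L n ≢ true → dot (suc n) L (_≡ᵇ n) ≡ false
  unit-solves {L} Ln≢true =
    cong₂ _xor_ (cong (_∧ (n ≡ᵇ n)) (¬-not Ln≢true))
                (⨁<-zero n λ a a<n → trans (cong (L a ∧_) (≢⇒≡ᵇ≡false (<⇒≢ a<n))) (∧-zeroʳ (L a)))

-- Adjacency matrices of bicliques and of families of bicliques

bicliqueAdj : (ℕ → Bool) → (ℕ → Bool) → ℕ → ℕ → Bool
bicliqueAdj x y a b = (x a ∧ y b) xor (y a ∧ x b)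

bicliqueAdj-comm : ∀ x y a b → bicliqueAdj x y a b ≡ bicliqueAdj y x a b
bicliqueAdj-comm x y a b = xor-comm (x a ∧ y b) (y a ∧ x b)

bicliqueAdj-diagonal : ∀ x y a → bicliqueAdj x y a a ≡ false
bicliqueAdj-diagonal x y a = trans (cong ((x a ∧ y a) xor_) (∧-comm (y a) (x a))) (xor-same (x a ∧ y a))

bicliqueAdj-xorʳ : ∀ x y y′ a b →
  bicliqueAdj x (λ c → y c xor y′ c) a b ≡ bicliqueAdj x y a b xor bicliqueAdj x y′ a b
bicliqueAdj-xorʳ x y y′ a b = begin
  (x a ∧ (y b xor y′ b)) xor ((y a xor y′ a) ∧ x b)
    ≡⟨ cong₂ _xor_ (∧-distribˡ-xor (x a) (y b) (y′ b)) (∧-distribʳ-xor (x b) (y a) (y′ a)) ⟩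
  ((x a ∧ y b) xor (x a ∧ y′ b)) xor ((y a ∧ x b) xor (y′ a ∧ x b))
    ≡⟨ interchange (x a ∧ y b) (x a ∧ y′ b) (y a ∧ x b) (y′ a ∧ x b) ⟩
  bicliqueAdj x y a b xor bicliqueAdj x y′ a b ∎

bicliqueAdj-dot : ∀ x y w n a →
  ⨁[ b < n ] (bicliqueAdj x y a b ∧ w b) ≡ (x a ∧ dot n y w) xor (y a ∧ dot n x w)
bicliqueAdj-dot x y w n a = begin
  ⨁[ b < n ] (((x a ∧ y b) xor (y a ∧ x b)) ∧ w b)
    ≡⟨ ⨁-cong (λ b → trans (∧-distribʳ-xor (w b) (x a ∧ y b) (y a ∧ x b))
                           (cong₂ _xor_ (∧-assoc (x a) (y b) (w b)) (∧-assoc (y a) (x b) (w b))))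
              (downFrom n) ⟩
  ⨁[ b < n ] ((x a ∧ (y b ∧ w b)) xor (y a ∧ (x b ∧ w b)))
    ≡⟨ ⨁-xor _ _ (downFrom n) ⟩
  (⨁[ b < n ] (x a ∧ (y b ∧ w b))) xor (⨁[ b < n ] (y a ∧ (x b ∧ w b)))
    ≡⟨ sym (cong₂ _xor_ (∧-distribˡ-⨁ (x a) _ (downFrom n)) (∧-distribˡ-⨁ (y a) _ (downFrom n))) ⟩
  (x a ∧ dot n y w) xor (y a ∧ dot n x w) ∎

bicliqueAdj-triangle : ∀ x y → (∀ a → x a ∧ y a ≡ false) → ∀ n →
  ⨁[ a < n ] ⨁[ b < a ] bicliqueAdj x y a b ≡ (⨁[ a < n ] x a) ∧ (⨁[ a < n ] y a)
bicliqueAdj-triangle x y disj zero    = refl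
bicliqueAdj-triangle x y disj (suc n) = begin
  (⨁[ b < n ] bicliqueAdj x y n b) xor (⨁[ a < n ] ⨁[ b < a ] bicliqueAdj x y a b)
    ≡⟨ cong₂ _xor_ last-row (bicliqueAdj-triangle x y disj n) ⟩
  ((x n ∧ ⨁< n y) xor (y n ∧ ⨁< n x)) xor (⨁< n x ∧ ⨁< n y)
    ≡⟨ triangle-step (x n) (y n) (⨁< n x) (⨁< n y) (disj n) ⟩
  (x n xor ⨁< n x) ∧ (y n xor ⨁< n y) ∎
  where
  last-row : ⨁[ b < n ] bicliqueAdj x y n b ≡ (x n ∧ ⨁< n y) xor (y n ∧ ⨁< n x)
  last-row = trans (⨁-xor _ _ (downFrom n))
                   (sym (cong₂ _xor_ (∧-distribˡ-⨁ (x n) y (downFrom n))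
                                     (∧-distribˡ-⨁ (y n) x (downFrom n))))

module _ (x y : A → ℕ → Bool) where

  sides : List A → List (ℕ → Bool)
  sides []       = []
  sides (B ∷ Bs) = x B ∷ y B ∷ sides Bs

  length-sides : ∀ Bs → length (sides Bs) ≡ length Bs * 2
  length-sides []       = refl
  length-sides (B ∷ Bs) = cong (suc ∘ suc) (length-sides Bs)

  All-sides : ∀ {P : (ℕ → Bool) → Set} {Bs} → All P (sides Bs) → All (λ B → P (x B) × P (y B)) Bs
  All-sides {Bs = []}     []             = []
  All-sides {Bs = B ∷ Bs} (px ∷ py ∷ ps) = (px , py) ∷ All-sides ps

  family-dot : ∀ {n w Bs} → All (λ B → dot n (x B) w ≡ false × dot n (y B) w ≡ false) Bs →
    ∀ a → ⨁[ b < n ] ((⨁[ B ∈ Bs ] bicliqueAdj (x B) (y B) a b) ∧ w b) ≡ false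
  family-dot {n} {w} {Bs} orthogonal a = begin
    ⨁[ b < n ] ((⨁[ B ∈ Bs ] bicliqueAdj (x B) (y B) a b) ∧ w b)
      ≡⟨ ⨁-cong (λ b → ∧-distribʳ-⨁ (w b) _ Bs) (downFrom n) ⟩
    ⨁[ b < n ] ⨁[ B ∈ Bs ] (bicliqueAdj (x B) (y B) a b ∧ w b)
      ≡⟨ ⨁-comm (λ b B → bicliqueAdj (x B) (y B) a b ∧ w b) (downFrom n) Bs ⟩
    ⨁[ B ∈ Bs ] ⨁[ b < n ] (bicliqueAdj (x B) (y B) a b ∧ w b)
      ≡⟨ ⨁-cong (λ B → bicliqueAdj-dot (x B) (y B) w n a) Bs ⟩
    ⨁[ B ∈ Bs ] ((x B a ∧ dot n (y B) w) xor (y B a ∧ dot n (x B) w))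
      ≡⟨ ⨁-zero (All.map (λ (x⊥w , y⊥w) → cong₂ _xor_ (trans (cong (x _ a ∧_) y⊥w) (∧-zeroʳ _))
                                                       (trans (cong (y _ a ∧_) x⊥w) (∧-zeroʳ _)))
                         orthogonal) ⟩
    false ∎

  family-triangle : (∀ B a → x B a ∧ y B a ≡ false) → ∀ n Bs →
    ⨁[ a < n ] ⨁[ b < a ] ⨁[ B ∈ Bs ] bicliqueAdj (x B) (y B) a b
      ≡ ⨁[ B ∈ Bs ] ((⨁[ a < n ] x B a) ∧ (⨁[ a < n ] y B a))
  family-triangle disj n Bs = begin
    ⨁[ a < n ] ⨁[ b < a ] ⨁[ B ∈ Bs ] bicliqueAdj (x B) (y B) a b
      ≡⟨ ⨁-cong (λ a → ⨁-comm (λ b B → bicliqueAdj (x B) (y B) a b) (downFrom a) Bs) (downFrom n) ⟩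
    ⨁[ a < n ] ⨁[ B ∈ Bs ] ⨁[ b < a ] bicliqueAdj (x B) (y B) a b
      ≡⟨ ⨁-comm (λ a B → ⨁[ b < a ] bicliqueAdj (x B) (y B) a b) (downFrom n) Bs ⟩
    ⨁[ B ∈ Bs ] ⨁[ a < n ] ⨁[ b < a ] bicliqueAdj (x B) (y B) a b
      ≡⟨ ⨁-cong (λ B → bicliqueAdj-triangle (x B) (y B) (disj B) n) Bs ⟩
    ⨁[ B ∈ Bs ] ((⨁[ a < n ] x B a) ∧ (⨁[ a < n ] y B a)) ∎

-- From bicliques on Fin n to vectors indexed by ℕ

extend : ∀ {n} → (Fin n → Bool) → ℕ → Bool
extend {zero}  f a       = false
extend {suc n} f zero    = f Fin.zero
extend {suc n} f (suc a) = extend (f ∘ Fin.suc) a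

extend-toℕ : ∀ {n} (f : Fin n → Bool) u → extend f (toℕ u) ≡ f u
extend-toℕ f Fin.zero    = refl
extend-toℕ f (Fin.suc u) = extend-toℕ (f ∘ Fin.suc) u

extend-disjoint : ∀ {n} {f g : Fin n → Bool} → (∀ v → f v ∧ g v ≡ false) →
                  ∀ a → extend f a ∧ extend g a ≡ false
extend-disjoint {zero}  _    a       = refl
extend-disjoint {suc n} disj zero    = disj Fin.zero
extend-disjoint {suc n} disj (suc a) = extend-disjoint (disj ∘ Fin.suc) a

extX extY : ∀ {n} → Biclique n → ℕ → Bool
extX B = extend (X B)
extY B = extend (Y B)

ext-disjoint : ∀ {n} (B : Biclique n) a → extX B a ∧ extY B a ≡ false
ext-disjoint B = extend-disjoint (λ v → ¬both⇒∧≡false (disjoint B v))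

hasEdge-extend : ∀ {n} (B : Biclique n) u v →
                 hasEdge B u v ≡ bicliqueAdj (extX B) (extY B) (toℕ u) (toℕ v)
hasEdge-extend B u v = begin
  (X B u ∧ Y B v) ∨ (Y B u ∧ X B v)
    ≡⟨ disjoint-∨≡xor (X B u) (Y B u) (X B v) (Y B v) (¬both⇒∧≡false (disjoint B u)) ⟩
  (X B u ∧ Y B v) xor (Y B u ∧ X B v)
    ≡⟨ sym (cong₂ _xor_ (cong₂ _∧_ (extend-toℕ (X B) u) (extend-toℕ (Y B) v))
                        (cong₂ _∧_ (extend-toℕ (Y B) u) (extend-toℕ (X B) v))) ⟩
  bicliqueAdj (extX B) (extY B) (toℕ u) (toℕ v) ∎

fromSides : ∀ {n} (x y : ℕ → Bool) → (∀ a → x a ∧ y a ≡ false) → Biclique n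
fromSides x y disj = record
  { X        = x ∘ toℕ
  ; Y        = y ∘ toℕ
  ; disjoint = λ v (xv , yv) → contradiction (trans (sym (cong₂ _∧_ xv yv)) (disj (toℕ v))) λ ()
  }

hasEdge-fromSides : ∀ {n} x y disj (u v : Fin n) →
                    hasEdge (fromSides x y disj) u v ≡ bicliqueAdj x y (toℕ u) (toℕ v)
hasEdge-fromSides x y disj u v =
  disjoint-∨≡xor (x (toℕ u)) (y (toℕ u)) (x (toℕ v)) (y (toℕ v)) (disj (toℕ u))

Fin²⇒bounded : ∀ {n} (P : ℕ → ℕ → Set) → (∀ (u v : Fin n) → P (toℕ u) (toℕ v)) →
               ∀ {a b} → a < n → b < n → P a b
Fin²⇒bounded P P-Fin a<n b<n =
  subst₂ P (toℕ-fromℕ< a<n) (toℕ-fromℕ< b<n) (P-Fin (fromℕ< a<n) (fromℕ< b<n))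

module _ {n} {G : Graph n} {Bs : List (Biclique n)} where

  oddCover⇒parity : IsOddCover G Bs → ∀ u v → u ≢ v → ⨁[ B ∈ Bs ] hasEdge B u v ≡ G u v
  oddCover⇒parity odd u v u≢v = bit-injective (trans (sym (length-filterᵇ-%2 _ Bs)) (odd u v u≢v))

  parity⇒oddCover : (∀ u v → u ≢ v → ⨁[ B ∈ Bs ] hasEdge B u v ≡ G u v) → IsOddCover G Bs
  parity⇒oddCover parity u v u≢v = trans (length-filterᵇ-%2 _ Bs) (cong bit (parity u v u≢v))

module Cycle (K : ℕ) (2≤K : 2 ≤ K) where

  N : ℕ
  N = suc K

  next : ℕ → ℕ
  next a = suc a % N

  prev : ℕ → ℕ
  prev zero    = K
  prev (suc a) = a

  -- C N u v is cyc (toℕ u) (toℕ v) by definition.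
  cyc : ℕ → ℕ → Bool
  cyc a b = (next a ≡ᵇ b) ∨ (next b ≡ᵇ a)

  edgeAdj : ℕ → ℕ → ℕ → Bool
  edgeAdj e = bicliqueAdj (_≡ᵇ e) (_≡ᵇ next e)

  K≢0 : K ≢ 0
  K≢0 K≡0 = contradiction (subst (2 ≤_) K≡0 2≤K) λ ()

  1<N : 1 < N
  1<N = ≤-trans 2≤K (n≤1+n K)

  next-< : ∀ a → next a < N
  next-< a = m%n<n (suc a) N

  next-suc : ∀ {a} → suc a < N → next a ≡ suc a
  next-suc = m<n⇒m%n≡m

  next-K : next K ≡ 0
  next-K = n%n≡0 N

  prev-< : ∀ {a} → a < N → prev a < N
  prev-< {zero}  _    = n<1+n K
  prev-< {suc a} a<N = <-trans (n<1+n a) a<N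

  next≡ᵇ : ∀ {a b} → a < N → b < N → (next b ≡ᵇ a) ≡ (b ≡ᵇ prev a)
  next≡ᵇ {a} {b} a<N b<N with m<1+n⇒m<n∨m≡n b<N
  ... | inj₁ b<K = trans (cong (_≡ᵇ a) (next-suc (s≤s b<K))) (below a)
    where
    below : ∀ a → (suc b ≡ᵇ a) ≡ (b ≡ᵇ prev a)
    below zero    = sym (≢⇒≡ᵇ≡false (<⇒≢ b<K))
    below (suc c) = refl
  ... | inj₂ refl = trans (cong (_≡ᵇ a) next-K) (wrap a a<N)
    where
    wrap : ∀ a → a < N → (0 ≡ᵇ a) ≡ (K ≡ᵇ prev a)
    wrap zero    _    = sym (≡ᵇ-refl K)
    wrap (suc c) c<K = sym (≢⇒≡ᵇ≡false (>⇒≢ (s≤s⁻¹ c<K)))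

  next≢prev : ∀ {a} → a < N → next a ≢ prev a
  next≢prev {zero}  _   next≡K = <⇒≢ 2≤K (trans (sym (next-suc 1<N)) next≡K)
  next≢prev {suc c} a<N next≡c with m<1+n⇒m<n∨m≡n a<N
  ... | inj₁ a<K = <⇒≢ (m<n⇒m<1+n (n<1+n c)) (sym (trans (sym (next-suc (s≤s a<K))) next≡c))
  ... | inj₂ a≡K = <⇒≢ 2≤K (trans (cong suc (trans (sym (trans (cong next a≡K) next-K)) next≡c)) a≡K)

  next≢self : ∀ e → next e ≢ e
  next≢self e next≡e with m<1+n⇒m<n∨m≡n (subst (_< N) next≡e (next-< e))
  ... | inj₁ e<K  = 1+n≢n (trans (sym (next-suc (s≤s e<K))) next≡e)
  ... | inj₂ refl = K≢0 (trans (sym next≡e) next-K)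

  edge-disjoint : ∀ e a → (a ≡ᵇ e) ∧ (a ≡ᵇ next e) ≡ false
  edge-disjoint e = singletons-disjoint (≢-sym (next≢self e))

  cyc≡xor : ∀ {a b} → a < N → b < N → cyc a b ≡ (next a ≡ᵇ b) xor (next b ≡ᵇ a)
  cyc≡xor a<N b<N = ∨≡xor λ next-a≡b next-b≡a →
    next≢prev a<N (trans (≡ᵇ≡true⇒≡ next-a≡b) (≡ᵇ≡true⇒≡ (trans (sym (next≡ᵇ a<N b<N)) next-b≡a)))

  cyc-loopless : ∀ {a} → a < N → cyc a a ≡ false
  cyc-loopless {a} a<N = trans (cyc≡xor a<N a<N) (xor-same (next a ≡ᵇ a))

  cyc-row : ∀ {a b} → a < N → b < N → cyc a b ≡ (b ≡ᵇ next a) xor (b ≡ᵇ prev a)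
  cyc-row {a} {b} a<N b<N = trans (cyc≡xor a<N b<N) (cong₂ _xor_ (≡ᵇ-sym (next a) b) (next≡ᵇ a<N b<N))

  cyc-act : ∀ {a} (w : ℕ → Bool) → a < N → ⨁[ b < N ] (cyc a b ∧ w b) ≡ w (next a) xor w (prev a)
  cyc-act {a} w a<N = begin
    ⨁[ b < N ] (cyc a b ∧ w b)
      ≡⟨ ⨁<-cong N (λ b b<N → trans (cong (_∧ w b) (cyc-row a<N b<N))
                                     (∧-distribʳ-xor (w b) (b ≡ᵇ next a) (b ≡ᵇ prev a))) ⟩
    ⨁[ b < N ] (((b ≡ᵇ next a) ∧ w b) xor ((b ≡ᵇ prev a) ∧ w b))
      ≡⟨ ⨁-xor (λ b → (b ≡ᵇ next a) ∧ w b) (λ b → (b ≡ᵇ prev a) ∧ w b) (downFrom N) ⟩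
    (⨁[ b < N ] ((b ≡ᵇ next a) ∧ w b)) xor (⨁[ b < N ] ((b ≡ᵇ prev a) ∧ w b))
      ≡⟨ cong₂ _xor_ (⨁<-δ w (next-< a)) (⨁<-δ w (prev-< a<N)) ⟩
    w (next a) xor w (prev a) ∎

  cyc-edge-sum : ∀ {a b} → a < N → b < N → ⨁[ e < N ] edgeAdj e a b ≡ cyc a b
  cyc-edge-sum {a} {b} a<N b<N = begin
    ⨁[ e < N ] (((a ≡ᵇ e) ∧ (b ≡ᵇ next e)) xor ((a ≡ᵇ next e) ∧ (b ≡ᵇ e)))
      ≡⟨ ⨁-cong (λ e → cong₂ _xor_ (cong (_∧ (b ≡ᵇ next e)) (≡ᵇ-sym a e))
                                   (trans (∧-comm (a ≡ᵇ next e) (b ≡ᵇ e))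
                                          (cong (_∧ (a ≡ᵇ next e)) (≡ᵇ-sym b e))))
                (downFrom N) ⟩
    ⨁[ e < N ] (((e ≡ᵇ a) ∧ (b ≡ᵇ next e)) xor ((e ≡ᵇ b) ∧ (a ≡ᵇ next e)))
      ≡⟨ ⨁-xor (λ e → (e ≡ᵇ a) ∧ (b ≡ᵇ next e)) (λ e → (e ≡ᵇ b) ∧ (a ≡ᵇ next e)) (downFrom N) ⟩
    (⨁[ e < N ] ((e ≡ᵇ a) ∧ (b ≡ᵇ next e))) xor (⨁[ e < N ] ((e ≡ᵇ b) ∧ (a ≡ᵇ next e)))
      ≡⟨ cong₂ _xor_ (⨁<-δ (λ e → b ≡ᵇ next e) a<N) (⨁<-δ (λ e → a ≡ᵇ next e) b<N) ⟩
    (b ≡ᵇ next a) xor (a ≡ᵇ next b)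
      ≡⟨ cong₂ _xor_ (≡ᵇ-sym b (next a)) (≡ᵇ-sym a (next b)) ⟩
    (next a ≡ᵇ b) xor (next b ≡ᵇ a)
      ≡⟨ sym (cyc≡xor a<N b<N) ⟩
    cyc a b ∎

  oddCover⇒cyc : ∀ {Bs} → IsOddCover (C N) Bs → ∀ {a b} → a < N → b < N →
                 ⨁[ B ∈ Bs ] bicliqueAdj (extX B) (extY B) a b ≡ cyc a b
  oddCover⇒cyc {Bs} odd =
    Fin²⇒bounded (λ a b → ⨁[ B ∈ Bs ] bicliqueAdj (extX B) (extY B) a b ≡ cyc a b) on-Fin
    where
    on-Fin : ∀ u v → ⨁[ B ∈ Bs ] bicliqueAdj (extX B) (extY B) (toℕ u) (toℕ v) ≡ cyc (toℕ u) (toℕ v)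
    on-Fin u v with u Fin.≟ v
    ... | yes refl =
      trans (⨁-zero {xs = Bs} (All.universal (λ B → bicliqueAdj-diagonal (extX B) (extY B) (toℕ u)) Bs))
            (sym (cyc-loopless (toℕ<n u)))
    ... | no u≢v =
      trans (sym (⨁-cong (λ B → hasEdge-extend B u v) Bs)) (oddCover⇒parity {Bs = Bs} odd u v u≢v)

module OddCycle (h : ℕ) (1≤h : 1 ≤ h) where

  open Cycle (h * 2) (*-monoˡ-≤ 2 1≤h)

  next≡prev⇒constant : ∀ {w : ℕ → Bool} → (∀ {a} → a < N → w (next a) ≡ w (prev a)) →
                       ∀ {c} → c < N → w c ≡ w 0
  next≡prev⇒constant {w} balanced = constant
    where
    two-step : ∀ {c} → suc (suc c) < N → w (suc (suc c)) ≡ w c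
    two-step lt = trans (cong w (sym (next-suc lt))) (balanced (<-trans (n<1+n _) lt))

    even : ∀ j → j * 2 < N → w (j * 2) ≡ w 0
    even zero    _  = refl
    even (suc j) lt = trans (two-step lt) (even j (<-trans (m<n⇒m<1+n (n<1+n (j * 2))) lt))

    -- Since N is odd, the neighbour h * 2 of 0 other than 1 is even.
    w1≡w0 : w 1 ≡ w 0
    w1≡w0 = trans (cong w (sym (next-suc 1<N))) (trans (balanced (s≤s z≤n)) (even h ≤-refl))

    constant : ∀ {c} → c < N → w c ≡ w 0
    constant {zero}        _  = refl
    constant {suc zero}    _  = w1≡w0
    constant {suc (suc c)} lt = trans (two-step lt) (constant (<-trans (m<n⇒m<1+n (n<1+n c)) lt))

  cyc-triangle : ⨁[ a < N ] ⨁[ b < a ] cyc a b ≡ true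
  cyc-triangle = begin
    ⨁[ a < N ] ⨁[ b < a ] cyc a b
      ≡⟨ ⨁<-cong N (λ a a<N → ⨁<-cong a λ b b<a → sym (cyc-edge-sum a<N (<-trans b<a a<N))) ⟩
    ⨁[ a < N ] ⨁[ b < a ] ⨁[ e < N ] edgeAdj e a b
      ≡⟨ family-triangle (λ e → _≡ᵇ e) (λ e → _≡ᵇ next e) edge-disjoint N (downFrom N) ⟩
    ⨁[ e < N ] ((⨁[ a < N ] (a ≡ᵇ e)) ∧ (⨁[ a < N ] (a ≡ᵇ next e)))
      ≡⟨ ⨁<-cong N (λ e e<N → cong₂ _∧_ (⨁<-indicator e<N) (⨁<-indicator (next-< e))) ⟩
    ⨁[ _ < N ] true
      ≡⟨ ⨁<-true-odd h ⟩
    true ∎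

  odd-cover-sides-unsolvable : ∀ {Bs} → IsOddCover (C N) Bs → ¬ NontrivialSolution N (sides extX extY Bs)
  odd-cover-sides-unsolvable {Bs} odd (w , (a , a<N , wa) , solves) = contradiction (begin
    true
      ≡⟨ sym cyc-triangle ⟩
    ⨁[ a < N ] ⨁[ b < a ] cyc a b
      ≡⟨ ⨁<-cong N (λ a a<N → ⨁<-cong a λ b b<a → sym (oddCover⇒cyc {Bs} odd a<N (<-trans b<a a<N))) ⟩
    ⨁[ a < N ] ⨁[ b < a ] ⨁[ B ∈ Bs ] bicliqueAdj (extX B) (extY B) a b
      ≡⟨ family-triangle extX extY ext-disjoint N Bs ⟩
    ⨁[ B ∈ Bs ] ((⨁[ a < N ] extX B a) ∧ (⨁[ a < N ] extY B a))
      ≡⟨ ⨁-zero (All.map (λ {B} (x⊥w , _) → cong (_∧ (⨁[ a < N ] extY B a)) (trans (sum≡dot (extX B)) x⊥w))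
                         orthogonal) ⟩
    false ∎) λ ()
    where
    orthogonal : All (λ B → dot N (extX B) w ≡ false × dot N (extY B) w ≡ false) Bs
    orthogonal = All-sides extX extY solves

    balanced : ∀ {c} → c < N → w (next c) ≡ w (prev c)
    balanced {c} c<N = xor≡false⇒≡ (begin
      w (next c) xor w (prev c)
        ≡⟨ sym (cyc-act w c<N) ⟩
      ⨁[ b < N ] (cyc c b ∧ w b)
        ≡⟨ ⨁<-cong N (λ b b<N → cong (_∧ w b) (sym (oddCover⇒cyc {Bs} odd c<N b<N))) ⟩
      ⨁[ b < N ] ((⨁[ B ∈ Bs ] bicliqueAdj (extX B) (extY B) c b) ∧ w b)
        ≡⟨ family-dot extX extY {N} {w} {Bs} orthogonal c ⟩
      false ∎)

    w≡true : ∀ {c} → c < N → w c ≡ true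
    w≡true c<N =
      trans (next≡prev⇒constant balanced c<N) (trans (sym (next≡prev⇒constant balanced a<N)) wa)

    sum≡dot : ∀ v → ⨁[ c < N ] v c ≡ dot N v w
    sum≡dot v = ⨁<-cong N λ c c<N → sym (trans (cong (v c ∧_) (w≡true c<N)) (∧-identityʳ (v c)))

  lower-bound : ∀ Bs → IsOddCover (C N) Bs → suc h ≤ length Bs
  lower-bound Bs odd = ≮⇒≥ λ short →
    odd-cover-sides-unsolvable odd (fewer-equations⇒nontrivial-solution N (sides extX extY Bs)
      (s≤s (subst (_≤ h * 2) (sym (length-sides extX extY Bs)) (*-monoˡ-≤ 2 (s≤s⁻¹ short)))))

  centre leaves : ℕ → ℕ → Bool
  centre j   = _≡ᵇ suc (j * 2)
  leaves j c = (c ≡ᵇ suc (suc (j * 2))) xor (c ≡ᵇ j * 2)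

  star-disjoint : ∀ j a → centre j a ∧ leaves j a ≡ false
  star-disjoint j a = trans (∧-distribˡ-xor (centre j a) _ _)
    (cong₂ _xor_ (singletons-disjoint (<⇒≢ (n<1+n _)) a) (singletons-disjoint 1+n≢n a))

  star : ℕ → Biclique N
  star j = fromSides (centre j) (leaves j) (star-disjoint j)

  closing-disjoint : ∀ a → (a ≡ᵇ 0) ∧ (a ≡ᵇ h * 2) ≡ false
  closing-disjoint = singletons-disjoint (≢-sym K≢0)

  closing : Biclique N
  closing = fromSides (_≡ᵇ 0) (_≡ᵇ h * 2) closing-disjoint

  cover : List (Biclique N)
  cover = closing ∷ map star (downFrom h)

  length-cover : length cover ≡ suc h
  length-cover = cong suc (trans (length-map star (downFrom h)) (length-downFrom h))

  hasEdge-star : ∀ {j} → j < h → ∀ u v →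
    hasEdge (star j) u v ≡ edgeAdj (suc (j * 2)) (toℕ u) (toℕ v) xor edgeAdj (j * 2) (toℕ u) (toℕ v)
  hasEdge-star {j} j<h u v = begin
    hasEdge (star j) u v
      ≡⟨ hasEdge-fromSides (centre j) (leaves j) (star-disjoint j) u v ⟩
    bicliqueAdj (centre j) (leaves j) a b
      ≡⟨ bicliqueAdj-xorʳ (centre j) (_≡ᵇ suc (suc (j * 2))) (_≡ᵇ j * 2) a b ⟩
    bicliqueAdj (centre j) (_≡ᵇ suc (suc (j * 2))) a b xor bicliqueAdj (centre j) (_≡ᵇ j * 2) a b
      ≡⟨ cong₂ _xor_ (cong (λ q → bicliqueAdj (centre j) (_≡ᵇ q) a b) (sym (next-suc 2j+2<N)))
                     (trans (bicliqueAdj-comm (centre j) (_≡ᵇ j * 2) a b)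
                            (cong (λ q → bicliqueAdj (_≡ᵇ j * 2) (_≡ᵇ q) a b) (sym (next-suc 2j+1<N)))) ⟩
    edgeAdj (suc (j * 2)) a b xor edgeAdj (j * 2) a b ∎
    where
    a = toℕ u
    b = toℕ v
    2j+2<N : suc (suc (j * 2)) < N
    2j+2<N = s≤s (*-monoˡ-≤ 2 j<h)
    2j+1<N : suc (j * 2) < N
    2j+1<N = <-trans (n<1+n _) 2j+2<N

  hasEdge-closing : ∀ u v → hasEdge closing u v ≡ edgeAdj (h * 2) (toℕ u) (toℕ v)
  hasEdge-closing u v =
    trans (hasEdge-fromSides (_≡ᵇ 0) (_≡ᵇ h * 2) closing-disjoint u v)
          (trans (bicliqueAdj-comm (_≡ᵇ 0) (_≡ᵇ h * 2) (toℕ u) (toℕ v))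
                 (cong (λ q → bicliqueAdj (_≡ᵇ h * 2) (_≡ᵇ q) (toℕ u) (toℕ v)) (sym next-K)))

  cover-parity : ∀ u v → ⨁[ B ∈ cover ] hasEdge B u v ≡ C N u v
  cover-parity u v = begin
    hasEdge closing u v xor (⨁[ B ∈ map star (downFrom h) ] hasEdge B u v)
      ≡⟨ cong₂ _xor_ (hasEdge-closing u v) (⨁-map (λ B → hasEdge B u v) star (downFrom h)) ⟩
    edgeAdj (h * 2) a b xor (⨁[ j < h ] hasEdge (star j) u v)
      ≡⟨ cong (edgeAdj (h * 2) a b xor_) (⨁<-cong h λ j j<h → hasEdge-star j<h u v) ⟩
    edgeAdj (h * 2) a b xor (⨁[ j < h ] (edgeAdj (suc (j * 2)) a b xor edgeAdj (j * 2) a b))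
      ≡⟨ cong (edgeAdj (h * 2) a b xor_) (sym (⨁<-pairs (λ e → edgeAdj e a b) h)) ⟩
    ⨁[ e < N ] edgeAdj e a b
      ≡⟨ cyc-edge-sum (toℕ<n u) (toℕ<n v) ⟩
    C N u v ∎
    where
    a = toℕ u
    b = toℕ v

  b₂-odd-cycle : b₂≡ (C N) (suc h)
  b₂-odd-cycle =
    (cover , parity⇒oddCover {Bs = cover} (λ u v _ → cover-parity u v) , length-cover) , lower-bound

theorem5p1 : (n : ℕ) → 3 ≤ n → n % 2 ≡ 1 → b₂≡ (C n) ((n + 1) / 2)
theorem5p1 n 3≤n n-odd =
  subst₂ (λ m k → b₂≡ (C m) k) (sym n≡2h+1) (sym half) (OddCycle.b₂-odd-cycle h 1≤h)
  where
  h : ℕ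
  h = n / 2

  n≡2h+1 : n ≡ suc (h * 2)
  n≡2h+1 = trans (m≡m%n+[m/n]*n n 2) (cong (_+ h * 2) n-odd)

  1≤h : 1 ≤ h
  1≤h = *-cancelʳ-≤ 1 h 2 (s≤s⁻¹ (subst (3 ≤_) n≡2h+1 3≤n))

  half : (n + 1) / 2 ≡ suc h
  half = trans (cong (λ m → (m + 1) / 2) n≡2h+1)
               (trans (cong (_/ 2) (+-comm (suc (h * 2)) 1)) (m*n/n≡m (suc h) 2))
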